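{- Let $G$ be a finite connected undirected graph and $uv\in E(G)$. The edge $uv$ is stubborn if and only if there is no 2-edge-colouring $c:E(G)\to\{1,2\}$ of $G$ for which some properly coloured walk uses the edge $uv$ in both directions (i.e. traverses it at least once from $u$ to $v$ and at least once from $v$ to $u$).
   Context: A walk is a sequence of vertices with consecutive vertices adjacent (vertices and edges may repeat); its length is its number of edges; it is closed if it starts and ends at the same vertex. An edge is stubborn if it belongs to every closed walk of odd length in $G$. A walk in an edge-coloured graph is properly coloured if no two consecutive edges of it have the same colour. -}

module Defs where

open import Data.Nat using (ℕ; zero; suc)
open import Data.Nat.Properties using ()
open import Data.Fin using (Fin)
open import Data.Bool using (Bool)
open import Data.Product using (Σ; _×_; _,_; ∃)
open import Data.Sum using (_⊎_)
open import Relation.Binary.PropositionalEquality using (_≡_; _≢_)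
open import Relation.Nullary using (¬_)
open import Level using (Level; _⊔_) renaming (suc to lsuc)

record Graph (n : ℕ) : Set₁ where
  field
    Adj     : Fin n → Fin n → Set
    sym     : ∀ {x y} → Adj x y → Adj y x
    irrefl  : ∀ {x} → ¬ Adj x x

module _ {n : ℕ} (G : Graph n) where
  open Graph G

  data Walk : Fin n → Fin n → ℕ → Set where
    [_]  : (x : Fin n) → Walk x x zero
    _∷⟨_⟩_ : ∀ {y z k} (x : Fin n) → Adj x y → Walk y z k → Walk x z (suc k)

  data Steps (a b : Fin n) : ∀ {x y k} → Walk x y k → Set where
    here  : ∀ {z k} (e : Adj a b) (w : Walk b z k) → Steps a b (a ∷⟨ e ⟩ w)
    there : ∀ {x y z k} (e : Adj x y) {w : Walk y z k} →
            Steps a b w → Steps a b (x ∷⟨ e ⟩ w)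

  Uses : (a b : Fin n) → ∀ {x y k} → Walk x y k → Set
  Uses a b w = Steps a b w ⊎ Steps b a w

  data Odd : ℕ → Set where
    one  : Odd 1
    2+   : ∀ {k} → Odd k → Odd (suc (suc k))

  Connected : Set
  Connected = ∀ x y → ∃ λ k → Walk x y k

  Stubborn : (u v : Fin n) → Set
  Stubborn u v = ∀ x k → Odd k → (w : Walk x x k) → Uses u v w

  record EdgeColouring : Set where
    field
      col    : ∀ {x y} → Adj x y → Bool
      col-sym : ∀ {x y} (e : Adj x y) → col (sym e) ≡ col e
      -- colour depends only on the edge, not on the adjacency proof
      col-irr : ∀ {x y} (e e′ : Adj x y) → col e ≡ col e′

  module _ (c : EdgeColouring) where
    open EdgeColouring c
    data Proper : ∀ {x y k} → Walk x y k → Set where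
      nil  : ∀ x → Proper [ x ]
      one  : ∀ {x y} (e : Adj x y) → Proper (x ∷⟨ e ⟩ [ y ])
      cons : ∀ {x y z w k} (e : Adj x y) (f : Adj y z) {r : Walk z w k} →
             col e ≢ col f → Proper (y ∷⟨ f ⟩ r) →
             Proper (x ∷⟨ e ⟩ (y ∷⟨ f ⟩ r))

-- A properly 2-coloured walk alternates colours and both directions of uv carry the same
-- colour, so between a traversal u → v and the next traversal v → u it makes an odd number of
-- steps, none along uv: an odd closed walk at v avoiding uv.  Conversely, an odd closed walk
-- avoiding uv can be conjugated by a walk from an endpoint a of uv that avoids uv (the tail of
-- any walk from v after its last use of uv).  Shortcutting between two traversals of one edge
-- at steps of different parity keeps the closed walk odd, so we may assume that each edge is
-- only traversed at steps of one parity.  Colouring each edge by that parity, and uv by the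
-- other colour, the walk b → a, then the closed walk, then a → b is properly coloured.
module Submission where

open import Defs
open import Data.Nat using (ℕ; zero; suc; _+_; _<_; s≤s)
open import Data.Nat.Properties using (+-suc; +-monoʳ-≤; m≤n+m; n≤1+n; ≤-trans)
open import Data.Nat.Induction using (<-rec)
open import Data.Fin using (Fin; _≟_)
open import Data.Bool using (Bool; true; false; not; _xor_; if_then_else_)
open import Data.Bool.Properties
  using (not-involutive; not-¬; ¬-not; not-distribˡ-xor; not-distribʳ-xor;
         xor-assoc; xor-comm; xor-same; xor-identityʳ)
  renaming (_≟_ to _≟ᵇ_)
open import Data.Maybe using (Maybe; just; nothing; fromMaybe)
import Data.Maybe as Maybe
open import Data.Maybe.Properties using (just-injective) renaming (≡-dec to ≡-decᴹ)
open import Data.Product using (Σ; _×_; _,_; ∃; proj₂)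
open import Data.Sum using (_⊎_; inj₁; inj₂; [_,_]′)
open import Data.Unit using (⊤; tt)
open import Data.Empty using (⊥-elim)
open import Function using (id; _∘_)
open import Relation.Nullary using (¬_; Dec; yes; no; does)
open import Relation.Nullary.Decidable using (_×-dec_; _⊎-dec_; dec-true; dec-false; does-⇔)
open import Relation.Binary.PropositionalEquality
  using (_≡_; _≢_; refl; sym; trans; cong; subst; module ≡-Reasoning)
open import Function.Bundles using (_⇔_; mk⇔)

parity : ℕ → Bool
parity zero    = false
parity (suc k) = not (parity k)

parity-+ : ∀ m k → parity (m + k) ≡ parity m xor parity k
parity-+ zero    k = refl
parity-+ (suc m) k = trans (cong not (parity-+ m k)) (not-distribˡ-xor (parity m) (parity k))

parity-conjugate : ∀ j k → parity (j + (k + j)) ≡ parity k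
parity-conjugate j k = begin
  parity (j + (k + j))                 ≡⟨ parity-+ j (k + j) ⟩
  parity j xor parity (k + j)          ≡⟨ cong (parity j xor_) (parity-+ k j) ⟩
  parity j xor (parity k xor parity j) ≡⟨ cong (parity j xor_) (xor-comm (parity k) (parity j)) ⟩
  parity j xor (parity j xor parity k) ≡⟨ sym (xor-assoc (parity j) (parity j) (parity k)) ⟩
  (parity j xor parity j) xor parity k ≡⟨ cong (_xor parity k) (xor-same (parity j)) ⟩
  parity k                             ∎
  where open ≡-Reasoning

parity-skip : ∀ k₁ k₂ → parity (suc (k₁ + suc k₂)) ≡ parity (k₁ + k₂)
parity-skip k₁ k₂ rewrite +-suc k₁ k₂ = not-involutive (parity (k₁ + k₂))

not-xor-swap : ∀ p q → not p xor q ≡ p xor not q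
not-xor-swap p q = trans (sym (not-distribˡ-xor p q)) (not-distribʳ-xor p q)

xor-fixed⇒true : ∀ c p → c ≡ not p xor c → p ≡ true
xor-fixed⇒true c true  _    = refl
xor-fixed⇒true c false c≡¬c = ⊥-elim (not-¬ refl c≡¬c)

map-not≡just : ∀ {m q} → Maybe.map not m ≡ just q → m ≡ just (not q)
map-not≡just {just r} refl = cong just (sym (not-involutive r))

module _ {n : ℕ} where

  SameEdge : (x y a b : Fin n) → Set
  SameEdge x y a b = (x ≡ a × y ≡ b) ⊎ (x ≡ b × y ≡ a)

  sameEdge? : (x y a b : Fin n) → Dec (SameEdge x y a b)
  sameEdge? x y a b = (x ≟ a ×-dec y ≟ b) ⊎-dec (x ≟ b ×-dec y ≟ a)

  SameEdge-refl : {x y : Fin n} → SameEdge x y x y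
  SameEdge-refl = inj₁ (refl , refl)

  SameEdge-flip : {x y : Fin n} → SameEdge x y y x
  SameEdge-flip = inj₂ (refl , refl)

  SameEdge-swapʳ : {x y a b : Fin n} → SameEdge x y a b → SameEdge x y b a
  SameEdge-swapʳ (inj₁ eqs) = inj₂ eqs
  SameEdge-swapʳ (inj₂ eqs) = inj₁ eqs

module _ {n : ℕ} (G : Graph n) where
  open Graph G renaming (sym to adj-sym)
  open EdgeColouring

  private variable
    a b s t u v x y z : Fin n
    j k L : ℕ
    p q : Bool

  snoc : Walk G x y k → Adj y z → Walk G x z (suc k)
  snoc [ x ]         e = x ∷⟨ e ⟩ [ _ ]
  snoc (x ∷⟨ f ⟩ w) e = x ∷⟨ f ⟩ snoc w e

  _++_ : Walk G x y j → Walk G y z k → Walk G x z (j + k)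
  [ x ]         ++ w′ = w′
  (x ∷⟨ e ⟩ w) ++ w′ = x ∷⟨ e ⟩ (w ++ w′)

  reverse : Walk G x y k → Walk G y x k
  reverse [ x ]         = [ x ]
  reverse (x ∷⟨ e ⟩ w) = snoc (reverse w) (adj-sym e)

  Steps-snoc : (w : Walk G x y k) (e : Adj y z) → Steps G y z (snoc w e)
  Steps-snoc [ x ]         e = here e [ _ ]
  Steps-snoc (x ∷⟨ f ⟩ w) e = there f (Steps-snoc w e)

  Avoids : (a b : Fin n) → Walk G x y k → Set
  Avoids a b [ x ]                  = ⊤
  Avoids a b (_∷⟨_⟩_ {y} x e w) = ¬ SameEdge x y a b × Avoids a b w

  Avoids-snoc : (w : Walk G x y k) (e : Adj y z) → Avoids a b w → ¬ SameEdge y z a b →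
                Avoids a b (snoc w e)
  Avoids-snoc [ x ]         e _          ¬ab = ¬ab , tt
  Avoids-snoc (x ∷⟨ f ⟩ w) e (¬xy , av) ¬ab = ¬xy , Avoids-snoc w e av ¬ab

  Avoids-++ : (w : Walk G x y j) (w′ : Walk G y z k) → Avoids a b w → Avoids a b w′ →
              Avoids a b (w ++ w′)
  Avoids-++ [ x ]         w′ _          av′ = av′
  Avoids-++ (x ∷⟨ e ⟩ w) w′ (¬xy , av) av′ = ¬xy , Avoids-++ w w′ av av′

  Avoids-reverse : (w : Walk G x y k) → Avoids a b w → Avoids a b (reverse w)
  Avoids-reverse [ x ]         _          = tt
  Avoids-reverse (x ∷⟨ e ⟩ w) (¬xy , av) =
    Avoids-snoc (reverse w) (adj-sym e) (Avoids-reverse w av) (¬xy ∘ SameEdge-swapʳ ∘ swapˡ)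
    where
    swapˡ : SameEdge y x a b → SameEdge x y b a
    swapˡ (inj₁ (refl , refl)) = SameEdge-refl
    swapˡ (inj₂ (refl , refl)) = SameEdge-flip

  Avoids-swap : (w : Walk G x y k) → Avoids a b w → Avoids b a w
  Avoids-swap [ x ]         _          = tt
  Avoids-swap (x ∷⟨ e ⟩ w) (¬xy , av) = ¬xy ∘ SameEdge-swapʳ , Avoids-swap w av

  Avoids⇒¬Steps : (w : Walk G x y k) → Avoids a b w → ¬ Steps G a b w
  Avoids⇒¬Steps _ (¬ab , _)  (here e w)    = ¬ab SameEdge-refl
  Avoids⇒¬Steps _ (_ , av)   (there e uses) = Avoids⇒¬Steps _ av uses

  Avoids⇒¬Uses : (w : Walk G x y k) → Avoids a b w → ¬ Uses G a b w
  Avoids⇒¬Uses w av = [ Avoids⇒¬Steps w av , Avoids⇒¬Steps w (Avoids-swap w av) ]′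

  uses-or-avoids : (a b : Fin n) (w : Walk G x y k) → Uses G a b w ⊎ Avoids a b w
  uses-or-avoids a b [ x ] = inj₂ tt
  uses-or-avoids a b (_∷⟨_⟩_ {y} x e w) with sameEdge? x y a b | uses-or-avoids a b w
  ... | yes (inj₁ (refl , refl)) | _                 = inj₁ (inj₁ (here e w))
  ... | yes (inj₂ (refl , refl)) | _                 = inj₁ (inj₂ (here e w))
  ... | no _                     | inj₁ (inj₁ steps) = inj₁ (inj₁ (there e steps))
  ... | no _                     | inj₁ (inj₂ steps) = inj₁ (inj₂ (there e steps))
  ... | no ¬ab                   | inj₂ av           = inj₂ (¬ab , av)

  avoidingSuffix : (a b : Fin n) → Walk G y x j →
                   ∃ λ s → (s ≡ y ⊎ s ≡ a ⊎ s ≡ b) × ∃ λ k → Σ (Walk G s x k) (Avoids a b)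
  avoidingSuffix a b [ x ] = x , inj₁ refl , 0 , [ x ] , tt
  avoidingSuffix a b (_∷⟨_⟩_ {y} x e w) with avoidingSuffix a b w | sameEdge? x y a b
  ... | s , inj₂ s∈ab , rest        | _                     = s , inj₂ s∈ab , rest
  ... | s , inj₁ refl , rest        | yes (inj₁ (_ , refl)) = s , inj₂ (inj₂ refl) , rest
  ... | s , inj₁ refl , rest        | yes (inj₂ (_ , refl)) = s , inj₂ (inj₁ refl) , rest
  ... | s , inj₁ refl , k , w′ , av | no ¬ab                = x , inj₁ refl , suc k , x ∷⟨ e ⟩ w′ , ¬ab , av

  Odd⇒parity : Odd G k → parity k ≡ true
  Odd⇒parity one          = refl
  Odd⇒parity (2+ {k} odd) = trans (not-involutive (parity k)) (Odd⇒parity odd)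

  parity⇒Odd : ∀ k → parity k ≡ true → Odd G k
  parity⇒Odd (suc zero)    _   = one
  parity⇒Odd (suc (suc k)) odd = 2+ (parity⇒Odd k (trans (sym (not-involutive (parity k))) odd))

  OddClosedAvoiding : (a b : Fin n) → Set
  OddClosedAvoiding a b = ∃ λ x → ∃ λ k → Odd G k × Σ (Walk G x x k) (Avoids a b)

  ProperBothWays : (a b : Fin n) → Set
  ProperBothWays a b = Σ (EdgeColouring G) λ c → ∃ λ x → ∃ λ y → ∃ λ k →
    Σ (Walk G x y k) λ w → Proper G c w × Steps G a b w × Steps G b a w

  Alternating : EdgeColouring G → Bool → Walk G x y k → Set
  Alternating c p [ x ]         = ⊤
  Alternating c p (x ∷⟨ e ⟩ w) = col c e ≡ p × Alternating c (not p) w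

  Alternating-snoc : (c : EdgeColouring G) (w : Walk G x y k) (e : Adj y z) →
                     Alternating c p w → col c e ≡ p xor parity k → Alternating c p (snoc w e)
  Alternating-snoc {p = p} c [ x ] e _ e≡ = trans e≡ (xor-identityʳ p) , tt
  Alternating-snoc {k = suc k} {p = p} c (x ∷⟨ f ⟩ w) e (f≡ , alt) e≡ =
    f≡ , Alternating-snoc c w e alt (trans e≡ (sym (not-xor-swap p (parity k))))

  alternating⇒proper : (c : EdgeColouring G) (w : Walk G x y k) → Alternating c p w → Proper G c w
  alternating⇒proper c [ x ]                    _               = nil x
  alternating⇒proper c (x ∷⟨ e ⟩ [ y ])         _               = one e
  alternating⇒proper c (x ∷⟨ e ⟩ (y ∷⟨ f ⟩ w)) (e≡ , f≡ , alt) =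
    cons e f (λ e≡f → not-¬ e≡ (trans e≡f f≡)) (alternating⇒proper c (y ∷⟨ f ⟩ w) (f≡ , alt))

  proper⇒alternating : (c : EdgeColouring G) (e : Adj x y) (w : Walk G y z k) →
                       Proper G c (x ∷⟨ e ⟩ w) → Alternating c (col c e) (x ∷⟨ e ⟩ w)
  proper⇒alternating c e _ (one _)               = refl , tt
  proper⇒alternating c e _ (cons e f {w} e≢f pr) =
    refl , subst (λ q → Alternating c q (_ ∷⟨ f ⟩ w)) (¬-not (e≢f ∘ sym)) (proper⇒alternating c f w pr)

  module ReturnOdd (c : EdgeColouring G) (s t : Fin n) (c₀ : Bool)
                   (col-st : ∀ {x y} (e : Adj x y) → SameEdge x y s t → col c e ≡ c₀) where

    closes : (Q : Walk G t t j) → Avoids s t Q → c₀ ≡ not (parity j) xor c₀ → OddClosedAvoiding s t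
    closes {j} Q av c₀≡ = t , j , parity⇒Odd j (xor-fixed⇒true c₀ (parity j) c₀≡) , Q , av

    -- Q is the part of the walk since its last traversal s → t, whose colour is c₀.
    returnOdd : (Q : Walk G t y j) → Avoids s t Q → (R : Walk G y z k) → Alternating c q R →
                q ≡ not (parity j) xor c₀ → Steps G t s R → OddClosedAvoiding s t
    returnOdd Q av _ (e≡ , _) q≡ (here e R) =
      closes Q av (trans (sym (col-st e SameEdge-flip)) (trans e≡ q≡))
    returnOdd {j = j} {q = q} Q av (_∷⟨_⟩_ {y′} y e R) (e≡ , alt) q≡ (there e steps)
      with sameEdge? y y′ s t
    ... | no ¬st = returnOdd (snoc Q e) (Avoids-snoc Q e av ¬st) R alt
                     (trans (cong not q≡) (not-distribˡ-xor (not (parity j)) c₀)) steps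
    ... | yes st@(inj₁ (refl , refl)) =
      returnOdd [ t ] tt R alt (cong not (trans (sym e≡) (col-st e st))) steps
    ... | yes st@(inj₂ (refl , refl)) = closes Q av (trans (sym (col-st e st)) (trans e≡ q≡))

  OddClosedAvoiding-swap : OddClosedAvoiding a b → OddClosedAvoiding b a
  OddClosedAvoiding-swap (x , k , odd , w , av) = x , k , odd , w , Avoids-swap w av

  module _ (c : EdgeColouring G) (euv : Adj u v) where

    col-uv : (e : Adj x y) → SameEdge x y u v → col c e ≡ col c euv
    col-uv e (inj₁ (refl , refl)) = col-irr c e euv
    col-uv e (inj₂ (refl , refl)) = trans (sym (col-sym c e)) (col-irr c (adj-sym e) euv)

    open ReturnOdd c u v (col c euv) col-uv renaming (returnOdd to returnOddᵘᵛ)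
    open ReturnOdd c v u (col c euv) (λ e → col-uv e ∘ SameEdge-swapʳ) renaming (returnOdd to returnOddᵛᵘ)

    alternatingBothWays : (w : Walk G x y k) → Alternating c q w →
                          Steps G u v w → Steps G v u w → OddClosedAvoiding u v
    alternatingBothWays _ (e≡ , alt) (here e w) (there e steps) =
      returnOddᵘᵛ [ v ] tt w alt (cong not (trans (sym e≡) (col-uv e SameEdge-refl))) steps
    alternatingBothWays _ (e≡ , alt) (there e steps) (here e w) = OddClosedAvoiding-swap
      (returnOddᵛᵘ [ u ] tt w alt (cong not (trans (sym e≡) (col-uv e SameEdge-flip))) steps)
    alternatingBothWays _ (_ , alt) (there e steps) (there e steps′) = alternatingBothWays _ alt steps steps′
    alternatingBothWays _ _ (here e _) (here _ _) = ⊥-elim (irrefl e)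

  properBothWays⇒oddClosedAvoiding : Adj u v → ProperBothWays u v → OddClosedAvoiding u v
  properBothWays⇒oddClosedAvoiding euv (c , _ , _ , _ , [ x ] , _ , () , _)
  properBothWays⇒oddClosedAvoiding euv (c , _ , _ , _ , x ∷⟨ e ⟩ w , pr , steps , steps′) =
    alternatingBothWays c euv _ (proper⇒alternating c e w pr) steps steps′

  firstParity : Walk G x y k → (a b : Fin n) → Maybe Bool
  firstParity [ x ]                  a b = nothing
  firstParity (_∷⟨_⟩_ {y} x e w) a b =
    if does (sameEdge? x y a b) then just false else Maybe.map not (firstParity w a b)

  firstParity-here : (e : Adj x y) (w : Walk G y z k) → SameEdge x y a b →
                     firstParity (x ∷⟨ e ⟩ w) a b ≡ just false
  firstParity-here {x} {y} {a = a} {b} _ _ ab rewrite dec-true (sameEdge? x y a b) ab = refl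

  firstParity-there : (e : Adj x y) (w : Walk G y z k) → ¬ SameEdge x y a b →
                      firstParity (x ∷⟨ e ⟩ w) a b ≡ Maybe.map not (firstParity w a b)
  firstParity-there {x} {y} {a = a} {b} _ _ ¬ab rewrite dec-false (sameEdge? x y a b) ¬ab = refl

  firstParity-swap : (w : Walk G x y k) (a b : Fin n) → firstParity w a b ≡ firstParity w b a
  firstParity-swap [ x ] a b = refl
  firstParity-swap (_∷⟨_⟩_ {y} x e w) a b
    rewrite does-⇔ (mk⇔ SameEdge-swapʳ SameEdge-swapʳ) (sameEdge? x y a b) (sameEdge? x y b a)
          | firstParity-swap w a b = refl

  firstParity-cong : (w : Walk G x y k) → SameEdge a b s t → firstParity w a b ≡ firstParity w s t
  firstParity-cong w (inj₁ (refl , refl)) = refl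
  firstParity-cong w (inj₂ (refl , refl)) = firstParity-swap w _ _

  Avoids⇒firstParity≡nothing : (w : Walk G x y k) → Avoids a b w → firstParity w a b ≡ nothing
  Avoids⇒firstParity≡nothing [ x ]         _          = refl
  Avoids⇒firstParity≡nothing (x ∷⟨ e ⟩ w) (¬ab , av) =
    trans (firstParity-there e w ¬ab) (cong (Maybe.map not) (Avoids⇒firstParity≡nothing w av))

  -- Indices in w are one less than in x ∷⟨ e ⟩ w: the next traversal of xy, if any, is at a
  -- step of the same parity as the first one.
  ParityConsistent : Walk G x y k → Set
  ParityConsistent [ x ]                  = ⊤
  ParityConsistent (_∷⟨_⟩_ {y} x e w) = firstParity w x y ≢ just false × ParityConsistent w

  consistent⇒alternating : (c : EdgeColouring G) (p : Bool) (w : Walk G x y k) → ParityConsistent w →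
    (∀ {a b} (e : Adj a b) {q} → firstParity w a b ≡ just q → col c e ≡ q xor p) → Alternating c p w
  consistent⇒alternating c p [ x ] _ _ = tt
  consistent⇒alternating c p (_∷⟨_⟩_ {y} x e w) (next , cw) col≡ =
    col≡ e (firstParity-here e w SameEdge-refl) , consistent⇒alternating c (not p) w cw col≡′
    where
    col≡′ : ∀ {a b} (e′ : Adj a b) {q} → firstParity w a b ≡ just q → col c e′ ≡ q xor not p
    col≡′ {a} {b} e′ {q} fp≡ with sameEdge? x y a b
    ... | no ¬xy = trans (col≡ e′ (trans (firstParity-there e w ¬xy) (cong (Maybe.map not) fp≡)))
                         (not-xor-swap q p)
    ... | yes xy with q
    ...   | true  = trans (col≡ e′ (firstParity-here e w xy)) (sym (not-involutive p))
    ...   | false = ⊥-elim (next (trans (firstParity-cong w xy) fp≡))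

  parityColouring : Walk G x y k → EdgeColouring G
  parityColouring w = record
    { col     = λ {x} {y} _ → fromMaybe true (firstParity w x y)
    ; col-sym = λ {x} {y} _ → cong (fromMaybe true) (firstParity-swap w y x)
    ; col-irr = λ _ _ → refl
    }

  -- ab is not traversed by Z, so it gets the default colour true, whereas Z alternates from
  -- false and, being odd, also ends with false.
  consistentOddClosed⇒properBothWays : Adj a b → (Z : Walk G a a L) → Avoids a b Z →
    ParityConsistent Z → parity L ≡ true → ProperBothWays a b
  consistentOddClosed⇒properBothWays {a} {b} {L} eab Z avZ cZ oddL =
    C , b , b , suc (suc L) , W , alternating⇒proper C W alt ,
    there (adj-sym eab) (Steps-snoc Z eab) , here (adj-sym eab) (snoc Z eab)
    where
    C : EdgeColouring G
    C = parityColouring Z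
    W : Walk G b b (suc (suc L))
    W = b ∷⟨ adj-sym eab ⟩ snoc Z eab
    untraversed : firstParity Z a b ≡ nothing
    untraversed = Avoids⇒firstParity≡nothing Z avZ
    alt : Alternating C true W
    alt = cong (fromMaybe true) (trans (firstParity-swap Z b a) untraversed)
        , Alternating-snoc C Z eab
            (consistent⇒alternating C false Z cZ
              (λ _ fp≡ → trans (cong (fromMaybe true) fp≡) (sym (xor-identityʳ _))))
            (trans (cong (fromMaybe true) untraversed) (sym oddL))

  module _ (u v : Fin n) where

    record AvoidingWalk (x z : Fin n) (p : Bool) : Set where
      constructor avoiding
      field
        {length} : ℕ
        walk     : Walk G x z length
        avoids   : Avoids u v walk
        parity≡  : parity length ≡ p

    record SplitAtTraversal (a b : Fin n) (q : Bool) (y z : Fin n) (k : ℕ) : Set where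
      constructor split
      field
        {a′ b′}       : Fin n
        {k₁ k₂}       : ℕ
        prefix        : Walk G y a′ k₁
        edge          : Adj a′ b′
        suffix        : Walk G b′ z k₂
        same          : SameEdge a′ b′ a b
        length≡       : k ≡ k₁ + suc k₂
        prefix-parity : parity k₁ ≡ q
        prefix-avoids : Avoids u v prefix
        suffix-avoids : Avoids u v suffix

    splitAtFirst : (w : Walk G y z k) → Avoids u v w → firstParity w a b ≡ just q →
                   SplitAtTraversal a b q y z k
    splitAtFirst [ y ] _ ()
    splitAtFirst {a = a} {b} {q} (_∷⟨_⟩_ {y′} y e w) (¬uv , av) fp≡ with sameEdge? y y′ a b
    ... | yes ab =
      split [ y ] e w ab refl (just-injective (trans (sym (firstParity-here e w ab)) fp≡)) tt av
    ... | no ¬ab with splitAtFirst w av (map-not≡just (trans (sym (firstParity-there e w ¬ab)) fp≡))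
    ...   | split R₁ f R₂ same len par₁ av₁ av₂ =
      split (y ∷⟨ e ⟩ R₁) f R₂ same (cong suc len) (trans (cong not par₁) (not-involutive q)) (¬uv , av₁) av₂

    Shortening : (x z : Fin n) (k : ℕ) → Set
    Shortening x z k = Σ (AvoidingWalk x z (parity k)) λ r → AvoidingWalk.length r < k

    -- x → y ⋯ x → y is replaced by the reversed middle part, x → y ⋯ y → x is deleted;
    -- either way an even number of steps is removed.
    shortcut : (e : Adj x y) → SplitAtTraversal x y false y z k → Shortening x z (suc k)
    shortcut e (split {k₁ = k₁} {k₂} R₁ _ R₂ (inj₁ (refl , refl)) refl _ av₁ av₂) =
      avoiding (reverse R₁ ++ R₂) (Avoids-++ (reverse R₁) R₂ (Avoids-reverse R₁ av₁) av₂)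
               (sym (parity-skip k₁ k₂)) ,
      s≤s (+-monoʳ-≤ k₁ (n≤1+n k₂))
    shortcut e (split {k₁ = k₁} {k₂} R₁ _ R₂ (inj₂ (refl , refl)) refl par₁ av₁ av₂) =
      avoiding R₂ av₂
               (sym (trans (parity-skip k₁ k₂) (trans (parity-+ k₁ k₂) (cong (_xor parity k₂) par₁)))) ,
      s≤s (≤-trans (n≤1+n k₂) (m≤n+m (suc k₂) k₁))

    shortenOrConsistent : (w : Walk G x z k) → Avoids u v w → Shortening x z k ⊎ ParityConsistent w
    shortenOrConsistent [ x ] _ = inj₂ tt
    shortenOrConsistent (_∷⟨_⟩_ {y} x e w) (¬uv , av) with shortenOrConsistent w av
    ... | inj₁ (avoiding w′ av′ par≡ , lt) =
      inj₁ (avoiding (x ∷⟨ e ⟩ w′) (¬uv , av′) (cong not par≡) , s≤s lt)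
    ... | inj₂ cw with ≡-decᴹ _≟ᵇ_ (firstParity w x y) (just false)
    ...   | yes fp≡ = inj₁ (shortcut e (splitAtFirst w av fp≡))
    ...   | no fp≢  = inj₂ (fp≢ , cw)

    ConsistentVersion : (x z : Fin n) (k : ℕ) → Set
    ConsistentVersion x z k = Σ (AvoidingWalk x z (parity k)) (ParityConsistent ∘ AvoidingWalk.walk)

    consistentVersion : (w : Walk G x z k) → Avoids u v w → ConsistentVersion x z k
    consistentVersion {x} {z} {k} = <-rec Motive step k
      where
      Motive : ℕ → Set
      Motive k = (w : Walk G x z k) → Avoids u v w → ConsistentVersion x z k
      step : ∀ k → (∀ {j} → j < k → Motive j) → Motive k
      step k rec w av with shortenOrConsistent w av
      ... | inj₂ cw = avoiding w av refl , cw
      ... | inj₁ (avoiding w′ av′ par≡ , lt) with rec lt w′ av′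
      ...   | avoiding w″ av″ par≡′ , cw = avoiding w″ av″ (trans par≡′ par≡) , cw

  ProperBothWays-swap : ProperBothWays a b → ProperBothWays b a
  ProperBothWays-swap (c , x , y , k , w , pr , steps , steps′) = c , x , y , k , w , pr , steps′ , steps

  oddClosedAvoiding⇒properBothWays : Connected G → Adj u v → OddClosedAvoiding u v → ProperBothWays u v
  oddClosedAvoiding⇒properBothWays {u} {v} conn euv (x , k , odd , w , av)
    with avoidingSuffix u v (proj₂ (conn v x))
  ... | s , s∈ , j , P , avP = atEndpoint ([ inj₂ , id ]′ s∈) (consistentVersion u v Z avZ)
    where
    Z : Walk G s s (j + (k + j))
    Z = P ++ (w ++ reverse P)
    avZ : Avoids u v Z
    avZ = Avoids-++ P (w ++ reverse P) avP (Avoids-++ w (reverse P) av (Avoids-reverse P avP))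
    oddZ : parity (j + (k + j)) ≡ true
    oddZ = trans (parity-conjugate j k) (Odd⇒parity odd)
    atEndpoint : s ≡ u ⊎ s ≡ v → ConsistentVersion u v s s (j + (k + j)) → ProperBothWays u v
    atEndpoint (inj₁ refl) (avoiding Z′ avZ′ par≡ , cZ′) =
      consistentOddClosed⇒properBothWays euv Z′ avZ′ cZ′ (trans par≡ oddZ)
    atEndpoint (inj₂ refl) (avoiding Z′ avZ′ par≡ , cZ′) = ProperBothWays-swap
      (consistentOddClosed⇒properBothWays (adj-sym euv) Z′ (Avoids-swap Z′ avZ′) cZ′ (trans par≡ oddZ))

  stubborn⇒noOddClosedAvoiding : Stubborn G u v → ¬ OddClosedAvoiding u v
  stubborn⇒noOddClosedAvoiding st (x , k , odd , w , av) = Avoids⇒¬Uses w av (st x k odd w)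

  noOddClosedAvoiding⇒stubborn : ¬ OddClosedAvoiding u v → Stubborn G u v
  noOddClosedAvoiding⇒stubborn {u} {v} ¬odd x k odd w =
    [ id , (λ av → ⊥-elim (¬odd (x , k , odd , w , av))) ]′ (uses-or-avoids u v w)

proposition2 : (n : ℕ) (G : Graph n) → Connected G →
    (u v : Fin n) → Graph.Adj G u v →
    Stubborn G u v ⇔
      (¬ Σ (EdgeColouring G) λ c → ∃ λ x → ∃ λ y → ∃ λ k →
         Σ (Walk G x y k) λ w →
           Proper G c w × Steps G u v w × Steps G v u w)
proposition2 n G conn u v euv = mk⇔
  (λ stubborn → stubborn⇒noOddClosedAvoiding G stubborn ∘ properBothWays⇒oddClosedAvoiding G euv)
  (λ noProper → noOddClosedAvoiding⇒stubborn G (noProper ∘ oddClosedAvoiding⇒properBothWays G conn euv))
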